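{- Let $\mathcal{C}\subseteq\mathbb{F}_q^{k\times m}$ be a non-zero linear code. Then (1) $\dim(\mathcal{C}) = |\mathrm{in}(\mathcal{C})|$, and (2) $\mathrm{in}(\mathcal{C})\subseteq[k-d(\mathcal{C})+1]\times[m]$.
   Context: $q$ prime power, $k\le m$ positive integers, $[n]=\{1,\dots,n\}$. A linear code is an $\mathbb{F}_q$-subspace of $\mathbb{F}_q^{k\times m}$; $d(\mathcal{C})$ is the minimum rank of a nonzero element. Let $\preceq$ be the lexicographic order on $[k]\times[m]$. The initial entry of a nonzero matrix $M$ is $\mathrm{in}(M)=\min_{\preceq}\{(i,j):M_{ij}\ne 0\}$, and the initial set of a nonzero linear code is $\mathrm{in}(\mathcal{C}) = \{\mathrm{in}(M): M\in\mathcal{C}, M\ne 0\}$. -}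

module Defs where

open import Level using (Level; _⊔_; suc)
open import Algebra.Bundles using (CommutativeRing)
open import Data.Nat using (ℕ; _≤_; _<_)
open import Data.Fin using (Fin; toℕ)
open import Data.Vec using (Vec; []; _∷_; map)
open import Data.Product using (Σ; _×_; _,_; ∃; ∃-syntax)
open import Data.List using (List)
open import Data.List.Membership.Propositional using (_∈_)
open import Data.List.Relation.Unary.Unique.Propositional using (Unique)
open import Relation.Binary.PropositionalEquality using (_≡_)
open import Relation.Nullary using (¬_)
open import Relation.Binary.Definitions using (Decidable)

-- Its size q is then
-- automatically a prime power.

record FiniteField (c ℓ : Level) : Set (suc (c ⊔ ℓ)) where
  field
    commRing : CommutativeRing c ℓ
  open CommutativeRing commRing public
  field
    1≉0      : ¬ (1# ≈ 0#)
    inverse  : ∀ x → ¬ (x ≈ 0#) → ∃[ y ] (x * y ≈ 1#)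
    _≟_      : Decidable _≈_
    elements : List Carrier
    complete : ∀ x → ∃[ y ] (y ∈ elements × x ≈ y)

module LinAlg {c ℓ} (F : FiniteField c ℓ) where
  open FiniteField F

  Vect : ∀ {i} → Set i → Set (c ⊔ i)
  Vect I = I → Carrier

  module _ {i} {I : Set i} where
    _≈v_ : Vect I → Vect I → Set (i ⊔ ℓ)
    u ≈v v = ∀ x → u x ≈ v x

    0v : Vect I
    0v _ = 0#

    _+v_ : Vect I → Vect I → Vect I
    (u +v v) x = u x + v x

    _·v_ : Carrier → Vect I → Vect I
    (a ·v v) x = a * v x

    lincomb : ∀ {n} → Vec Carrier n → Vec (Vect I) n → Vect I
    lincomb []       []       = 0v
    lincomb (a ∷ as) (v ∷ vs) = (a ·v v) +v lincomb as vs

    AllZero : ∀ {n} → Vec Carrier n → Set ℓ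
    AllZero []       = Level.Lift ℓ Data.Unit.⊤ where import Data.Unit
    AllZero (a ∷ as) = (a ≈ 0#) × AllZero as

    LinIndep : ∀ {n} → Vec (Vect I) n → Set (c ⊔ i ⊔ ℓ)
    LinIndep {n} vs = ∀ (as : Vec Carrier n) → lincomb as vs ≈v 0v → AllZero as

  Matrix : ℕ → ℕ → Set c
  Matrix k m = Fin k → Fin m → Carrier

  module _ {k m : ℕ} where
    flat : Matrix k m → Vect (Fin k × Fin m)
    flat M (i , j) = M i j

    _≈M_ : Matrix k m → Matrix k m → Set ℓ
    M ≈M N = ∀ i j → M i j ≈ N i j

    0M : Matrix k m
    0M _ _ = 0#

    _+M_ : Matrix k m → Matrix k m → Matrix k m
    (M +M N) i j = M i j + N i j

    _·M_ : Carrier → Matrix k m → Matrix k m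
    (a ·M M) i j = a * M i j

    NonZero : Matrix k m → Set ℓ
    NonZero M = ¬ (M ≈M 0M)

    HasRank : Matrix k m → ℕ → Set (c ⊔ ℓ)
    HasRank M r =
      (Σ (Vec (Fin k) r) λ rows → (Unique (Data.Vec.toList rows) × LinIndep (map M rows)))
      × (∀ {s} (rows : Vec (Fin k) s) → LinIndep (map M rows) → s ≤ r)
      where import Data.Vec

  record LinearCode (k m : ℕ) : Set (suc (c ⊔ ℓ)) where
    field
      member   : Matrix k m → Set (c ⊔ ℓ)
      resp     : ∀ {M N} → M ≈M N → member M → member N
      zero∈    : member 0M
      +-closed : ∀ {M N} → member M → member N → member (M +M N)
      ·-closed : ∀ a {M} → member M → member (a ·M M)
  open LinearCode public

  _∈C_ : ∀ {k m} → Matrix k m → LinearCode k m → Set (c ⊔ ℓ)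
  M ∈C C = member C M

  module _ {k m : ℕ} (C : LinearCode k m) where
    NonZeroCode : Set (c ⊔ ℓ)
    NonZeroCode = ∃[ M ] ((M ∈C C) × NonZero M)

    HasDim : ℕ → Set (c ⊔ ℓ)
    HasDim n = Σ (Vec (Matrix k m) n) λ B → ( (∀ t → Data.Vec.lookup B t ∈C C)
                      × LinIndep (map flat B)
                      × (∀ M → M ∈C C → ∃[ as ] (lincomb as (map flat B) ≈v flat M)) )
      where import Data.Vec

    HasMinDist : ℕ → Set (c ⊔ ℓ)
    HasMinDist d = (∃[ M ] ((M ∈C C) × NonZero M × HasRank M d))
                 × (∀ M r → M ∈C C → NonZero M → HasRank M r → d ≤ r)

  _≺_ : ∀ {k m} → Fin k × Fin m → Fin k × Fin m → Set
  (i , j) ≺ (i' , j') = (toℕ i < toℕ i') ⊎ ((i ≡ i') × (toℕ j < toℕ j'))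
    where open import Data.Sum using (_⊎_)

  IsInitial : ∀ {k m} → Matrix k m → Fin k × Fin m → Set ℓ
  IsInitial M (i , j) = ¬ (M i j ≈ 0#) × (∀ i' j' → (i' , j') ≺ (i , j) → M i' j' ≈ 0#)

  InSet : ∀ {k m} → LinearCode k m → Fin k × Fin m → Set (c ⊔ ℓ)
  InSet C p = ∃[ M ] ((M ∈C C) × NonZero M × IsInitial M p)

HasCard : ∀ {a p} {A : Set a} → (A → Set p) → ℕ → Set (a ⊔ p)
HasCard {A = A} P n =
  ∃[ xs ] (Data.List.length xs ≡ n × Unique xs × (∀ x → x ∈ xs → P x) × (∀ x → P x → x ∈ xs))
  where import Data.List

-- For (1), in(C) is decidable and listed in lexicographic order; codewords
-- starting at these positions form an echelon family, so |in(C)| ≤ dim C, while a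
-- codeword vanishing on in(C) is zero, so restricting a basis to the positions of in(C)
-- keeps it independent in F^|in(C)| and dim C ≤ |in(C)|.  For (2), a codeword starting
-- in row i has zero rows above i, so a greedy row basis shows rank ≤ k - i, and d(C)
-- is at most that rank.
module Submission where

open import Defs
open import Level using (_⊔_)
open import Data.Nat using (ℕ; zero; suc; _≤_; _<_; z≤n; s≤s)
import Data.Nat as ℕ using (_+_; _∸_)
import Data.Nat.Properties as ℕₚ
open import Data.Fin using (Fin; toℕ) renaming (zero to fzero; suc to fsuc)
import Data.Fin.Properties as Fin
open import Data.Vec as Vec using (Vec; []; _∷_; lookup; tabulate; insertAt; removeAt; replicate; map)
import Data.Vec.Properties as Vecₚ
open import Data.Vec.Relation.Binary.Pointwise.Inductive as Pointwise using (Pointwise; []; _∷_)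
open import Data.List.Relation.Unary.Any as Any using (here; there)
import Data.List.Relation.Unary.Any.Properties as Anyₚ
open import Data.List.Membership.Propositional as Mem using (_∈_)
import Data.List.Membership.Propositional.Properties as Memₚ
import Data.List.Properties as Lₚ
open import Data.List as L using (List; []; _∷_)
import Data.List.Relation.Unary.All as All
open import Data.List.Relation.Unary.AllPairs as AllPairs using (AllPairs; []; _∷_)
import Data.List.Relation.Unary.AllPairs.Properties as AllPairsₚ
import Data.List.Relation.Unary.All.Properties as Allₚ
open import Data.List.Relation.Unary.Unique.Propositional using (Unique)
import Data.Product as Product
open import Data.Product using (_×_; _,_; ∃; ∃-syntax; proj₁; proj₂)
open import Data.Sum using (_⊎_; inj₁; inj₂)
open import Data.Empty using (⊥-elim)
open import Function using (_∘_)
open import Relation.Nullary using (¬_; Dec; yes; no; ¬?)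
open import Relation.Nullary.Decidable using (decidable-stable; _⊎-dec_; _×-dec_; _→-dec_)
open import Relation.Unary using (Pred; Decidable)
open import Relation.Binary.Core using (Rel)
open import Relation.Binary.Definitions using (Asymmetric)
open import Relation.Binary.PropositionalEquality as ≡ using (_≡_)
import Algebra.Solver.Ring.NaturalCoefficients.Default as SemiringSolver

first-minimal : ∀ {a r p} {A : Set a} {_<_ : Rel A r} {P : Pred A p} → Asymmetric _<_ → Decidable P →
                ∀ {xs} → AllPairs _<_ xs → (∀ {x} → P x → x ∈ xs) →
                ∀ {x} → P x → ∃[ y ] (P y × ∀ {z} → z < y → ¬ P z)
first-minimal asym P? {[]} _ covers Px with covers Px
... | ()
first-minimal {_<_ = _<_} {P} asym P? {y ∷ ys} (y<ys ∷ sorted) covers Px with P? y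
... | yes Py = y , Py , λ z<y Pz → not-before z<y (covers Pz)
  where
    not-before : ∀ {z} → z < y → ¬ z ∈ y ∷ ys
    not-before z<y (here ≡.refl) = asym z<y z<y
    not-before z<y (there z∈ys)  = asym z<y (All.lookup y<ys z∈ys)
... | no ¬Py = first-minimal asym P? sorted covers′ Px
  where
    covers′ : ∀ {z} → P z → z ∈ ys
    covers′ Pz with covers Pz
    ... | here ≡.refl = ⊥-elim (¬Py Pz)
    ... | there z∈ys  = z∈ys

rowsFrom : ∀ k → ℕ → List (Fin k)
rowsFrom k       zero    = L.allFin k
rowsFrom zero    (suc i) = []
rowsFrom (suc k) (suc i) = L.map fsuc (rowsFrom k i)

length-rowsFrom : ∀ k i → L.length (rowsFrom k i) ≡ k ℕ.∸ i
length-rowsFrom k       zero    = Lₚ.length-tabulate (λ x → x)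
length-rowsFrom zero    (suc i) = ≡.refl
length-rowsFrom (suc k) (suc i) = ≡.trans (Lₚ.length-map fsuc (rowsFrom k i)) (length-rowsFrom k i)

∈-rowsFrom : ∀ {k i} (x : Fin k) → i ≤ toℕ x → x ∈ rowsFrom k i
∈-rowsFrom {i = zero}          x        _        = Memₚ.∈-allFin x
∈-rowsFrom {suc k} {i = suc i} (fsuc x) (s≤s i≤x) = Memₚ.∈-map⁺ fsuc (∈-rowsFrom x i≤x)

module Theory {c ℓ} (F : FiniteField c ℓ) where
  open FiniteField F
  open LinAlg F
  open import Relation.Binary.Reasoning.Setoid setoid
  open import Algebra.Properties.Ring ring
    using (-‿distribˡ-*; -‿distribʳ-*; -‿involutive; +-inverseʳ-unique)
  open SemiringSolver commutativeSemiring using (solve; _:+_; _:*_; _:=_)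

  cancel-nonzero : ∀ {a x} → ¬ a ≈ 0# → a * x ≈ 0# → x ≈ 0#
  cancel-nonzero {a} {x} a≉0 ax≈0 = begin
    x              ≈⟨ *-identityˡ x ⟨
    1# * x         ≈⟨ *-congʳ (trans (*-comm y a) ay≈1) ⟨
    (y * a) * x    ≈⟨ *-assoc y a x ⟩
    y * (a * x)    ≈⟨ *-congˡ ax≈0 ⟩
    y * 0#         ≈⟨ zeroʳ y ⟩
    0#             ∎
    where
      y = proj₁ (inverse a a≉0)
      ay≈1 = proj₂ (inverse a a≉0)

  eliminate : ∀ {p y} a → p * y ≈ 1# → a + - (a * y) * p ≈ 0#
  eliminate {p} {y} a py≈1 = begin
    a + - (a * y) * p     ≈⟨ +-congˡ (-‿distribˡ-* (a * y) p) ⟨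
    a + - ((a * y) * p)   ≈⟨ +-congˡ (-‿cong (*-assoc a y p)) ⟩
    a + - (a * (y * p))   ≈⟨ +-congˡ (-‿cong (*-congˡ (trans (*-comm y p) py≈1))) ⟩
    a + - (a * 1#)        ≈⟨ +-congˡ (-‿cong (*-identityʳ a)) ⟩
    a + - a               ≈⟨ -‿inverseʳ a ⟩
    0#                    ∎

  dot : ∀ {n} → Vec Carrier n → Vec Carrier n → Carrier
  dot []       []       = 0#
  dot (a ∷ as) (b ∷ bs) = a * b + dot as bs

  module _ {i} {I : Set i} where

    AllZero-reindex : ∀ {j} {J : Set j} {n} (as : Vec Carrier n) → AllZero {I = I} as → AllZero {I = J} as
    AllZero-reindex []       _        = _
    AllZero-reindex {J = J} (a ∷ as) (a≈0 , z) = a≈0 , AllZero-reindex {J = J} as z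

    lincomb-cong : ∀ {n} {as bs : Vec Carrier n} (vs : Vec (Vect I) n) →
                   Pointwise _≈_ as bs → lincomb as vs ≈v lincomb bs vs
    lincomb-cong []       []         x = refl
    lincomb-cong (v ∷ vs) (a≈b ∷ es) x = +-cong (*-congʳ a≈b) (lincomb-cong vs es x)

    lincomb-zeros : ∀ {n} (vs : Vec (Vect I) n) → lincomb (replicate n 0#) vs ≈v 0v
    lincomb-zeros []       x = refl
    lincomb-zeros (v ∷ vs) x = trans (+-cong (zeroˡ (v x)) (lincomb-zeros vs x)) (+-identityˡ 0#)

    lincomb-scale : ∀ {n} a (as : Vec Carrier n) (vs : Vec (Vect I) n) →
                    lincomb (map (a *_) as) vs ≈v (a ·v lincomb as vs)
    lincomb-scale a []       []       x = sym (zeroʳ a)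
    lincomb-scale a (b ∷ as) (v ∷ vs) x =
      trans (+-cong (*-assoc a b (v x)) (lincomb-scale a as vs x)) (sym (distribˡ a _ _))

    lincomb-vanishing : ∀ {n} (as : Vec Carrier n) (vs : Vec (Vect I) n) x →
                        (∀ t → lookup vs t x ≈ 0#) → lincomb as vs x ≈ 0#
    lincomb-vanishing []       []       x _  = refl
    lincomb-vanishing (a ∷ as) (v ∷ vs) x vx≈0 = begin
      a * v x + lincomb as vs x ≈⟨ +-cong (*-congˡ (vx≈0 fzero)) (lincomb-vanishing as vs x (vx≈0 ∘ fsuc)) ⟩
      a * 0# + 0#               ≈⟨ +-identityʳ _ ⟩
      a * 0#                    ≈⟨ zeroʳ a ⟩
      0#                        ∎

    drop-zero-head : ∀ {n a v} (as : Vec Carrier n) (vs : Vec (Vect I) n) →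
                     a ≈ 0# → lincomb (a ∷ as) (v ∷ vs) ≈v 0v → lincomb as vs ≈v 0v
    drop-zero-head {a = a} {v} as vs a≈0 rel x = begin
      lincomb as vs x               ≈⟨ +-identityˡ _ ⟨
      0# + lincomb as vs x          ≈⟨ +-congʳ (trans (*-congʳ a≈0) (zeroˡ (v x))) ⟨
      a * v x + lincomb as vs x     ≈⟨ rel x ⟩
      0#                            ∎

    lincomb-insert : ∀ {n} (as : Vec Carrier n) t x (vs : Vec (Vect I) (suc n)) →
      lincomb (insertAt as t x) vs ≈v ((x ·v lookup vs t) +v lincomb as (removeAt vs t))
    lincomb-insert as       fzero    x (v ∷ vs)          y = refl
    lincomb-insert (a ∷ as) (fsuc t) x (v ∷ vs@(_ ∷ _)) y = begin
      a * v y + lincomb (insertAt as t x) vs y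
        ≈⟨ +-congˡ (lincomb-insert as t x vs y) ⟩
      a * v y + (x * lookup vs t y + lincomb as (removeAt vs t) y)
        ≈⟨ solve 3 (λ u w z → u :+ (w :+ z) := w :+ (u :+ z)) refl _ _ _ ⟩
      x * lookup vs t y + (a * v y + lincomb as (removeAt vs t) y) ∎

    AllZero-insert : ∀ {n} (as : Vec Carrier n) t x → AllZero {I = I} (insertAt as t x) → AllZero {I = I} as
    AllZero-insert as       fzero    x (_ , z)   = z
    AllZero-insert (a ∷ as) (fsuc t) x (a≈0 , z) = a≈0 , AllZero-insert as t x z

    lincomb-shear : ∀ {n} (f : Vect I → Carrier) (w : Vect I) (as : Vec Carrier n) (vs : Vec (Vect I) n) →
      lincomb as (map (λ v → v +v (f v ·v w)) vs) ≈v (lincomb as vs +v (dot as (map f vs) ·v w))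
    lincomb-shear f w []       []       x = sym (trans (+-identityˡ _) (zeroˡ (w x)))
    lincomb-shear f w (a ∷ as) (v ∷ vs) x = begin
      a * (v x + f v * w x) + lincomb as (map (λ v → v +v (f v ·v w)) vs) x
        ≈⟨ +-congˡ (lincomb-shear f w as vs x) ⟩
      a * (v x + f v * w x) + (lincomb as vs x + dot as (map f vs) * w x)
        ≈⟨ solve 6 (λ a v fv wx L D → a :* (v :+ fv :* wx) :+ (L :+ D :* wx)
                                      := (a :* v :+ L) :+ (a :* fv :+ D) :* wx)
                   refl a (v x) (f v) (w x) (lincomb as vs x) (dot as (map f vs)) ⟩
      (a * v x + lincomb as vs x) + (a * f v + dot as (map f vs)) * w x ∎

  lincomb-reindex : ∀ {i j} {I : Set i} {J : Set j} (g : J → I) {n} (as : Vec Carrier n) (vs : Vec (Vect I) n) y →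
                    lincomb as (map (λ v → λ z → v (g z)) vs) y ≡ lincomb as vs (g y)
  lincomb-reindex g []       []       y = ≡.refl
  lincomb-reindex g (a ∷ as) (v ∷ vs) y = ≡.cong (a * v (g y) +_) (lincomb-reindex g as vs y)

  Dependency : ∀ {i} {I : Set i} {n} → Vec (Vect I) n → Set (c ⊔ i ⊔ ℓ)
  Dependency {I = I} vs = ∃[ as ] (¬ AllZero {I = I} as × lincomb as vs ≈v 0v)

  independent⇒¬dependency : ∀ {i} {I : Set i} {n} {vs : Vec (Vect I) n} → LinIndep vs → ¬ Dependency vs
  independent⇒¬dependency indep (as , as≉0 , rel) = as≉0 (indep as rel)

  transfer-dependency : ∀ {i j} {I : Set i} {J : Set j} {n} {us : Vec (Vect I) n} {vs : Vec (Vect J) n} →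
    (∀ as → lincomb as us ≈v 0v → lincomb as vs ≈v 0v) → Dependency us → Dependency vs
  transfer-dependency {I = I} {J} relate (as , as≉0 , rel) =
    as , as≉0 ∘ AllZero-reindex {I = J} {J = I} as , relate as rel

  tail : ∀ {b} → Vect (Fin (suc b)) → Vect (Fin b)
  tail v u = v (fsuc u)

  untail : ∀ {b n} (vs : Vec (Vect (Fin (suc b))) n) → (∀ t → lookup vs t fzero ≈ 0#) →
           Dependency (map tail vs) → Dependency vs
  untail vs first≈0 = transfer-dependency relate
    where
      relate : ∀ as → lincomb as (map tail vs) ≈v 0v → lincomb as vs ≈v 0v
      relate as _    fzero    = lincomb-vanishing as vs fzero first≈0
      relate as tail≈0 (fsuc u) = ≡.subst (_≈ 0#) (lincomb-reindex fsuc as vs u) (tail≈0 u)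

  module Pivot {b a} (vs : Vec (Vect (Fin (suc b))) (suc a)) (t : Fin (suc a))
               (piv0≉0 : ¬ lookup vs t fzero ≈ 0#) where
    piv : Vect (Fin (suc b))
    piv = lookup vs t

    clear-coeff : Vect (Fin (suc b)) → Carrier
    clear-coeff v = - (v fzero * proj₁ (inverse (piv fzero) piv0≉0))

    clear : Vect (Fin (suc b)) → Vect (Fin (suc b))
    clear v = v +v (clear-coeff v ·v piv)

    cleared : Vec (Vect (Fin (suc b))) a
    cleared = map clear (removeAt vs t)

    cleared-first : ∀ s → lookup cleared s fzero ≈ 0#
    cleared-first s = ≡.subst (λ v → v fzero ≈ 0#) (≡.sym (Vecₚ.lookup-map s clear (removeAt vs t)))
                              (eliminate _ (proj₂ (inverse (piv fzero) piv0≉0)))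

    -- Σ aₛ clear(vₛ) = Σ aₛ vₛ + S piv, so the relation gets coefficient S at position t.
    lift : Dependency cleared → Dependency vs
    lift (as , as≉0 , rel) = insertAt as t S , as≉0 ∘ AllZero-insert {I = Fin (suc b)} as t S , λ x → begin
      lincomb (insertAt as t S) vs x         ≈⟨ lincomb-insert as t S vs x ⟩
      S * piv x + lincomb as others x        ≈⟨ +-comm _ _ ⟩
      lincomb as others x + S * piv x        ≈⟨ lincomb-shear clear-coeff piv as others x ⟨
      lincomb as cleared x                   ≈⟨ rel x ⟩
      0#                                     ∎
      where
        others = removeAt vs t
        S = dot as (map clear-coeff others)

  overfull-dependent : ∀ b {a} → b < a → (vs : Vec (Vect (Fin b)) a) → Dependency vs
  overfull-dependent zero    {suc a} _          vs = 1# ∷ replicate a 0# , 1≉0 ∘ proj₁ , λ ()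
  overfull-dependent (suc b) {suc a} (s≤s b<a) vs with Fin.any? (λ t → ¬? (lookup vs t fzero ≟ 0#))
  ... | no no-pivot = untail vs first≈0 (overfull-dependent b (ℕₚ.m<n⇒m<1+n b<a) (map tail vs))
    where
      first≈0 : ∀ t → lookup vs t fzero ≈ 0#
      first≈0 t = decidable-stable (lookup vs t fzero ≟ 0#) (λ v≉0 → no-pivot (t , v≉0))
  ... | yes (t , piv0≉0) = lift (untail cleared cleared-first (overfull-dependent b b<a (map tail cleared)))
    where open Pivot vs t piv0≉0

  module _ {i} {I : Set i} where

    Span : ∀ {b} → Vec (Vect I) b → Vect I → Set (c ⊔ i ⊔ ℓ)
    Span ws v = ∃[ cs ] (lincomb cs ws ≈v v)

    lincomb-congʳ : ∀ {n} (as : Vec Carrier n) {us vs : Vec (Vect I) n} →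
                    (∀ t → lookup us t ≈v lookup vs t) → lincomb as us ≈v lincomb as vs
    lincomb-congʳ []       {[]}     {[]}     _     x = refl
    lincomb-congʳ (a ∷ as) {u ∷ us} {v ∷ vs} us≈vs x =
      +-cong (*-congˡ (us≈vs fzero x)) (lincomb-congʳ as (us≈vs ∘ fsuc) x)

    expand : ∀ {b} → Vec (Vect I) b → Vect (Fin b) → Vect I
    expand ws c = lincomb (tabulate c) ws

    expand-zero : ∀ {b} (ws : Vec (Vect I) b) → expand ws 0v ≈v 0v
    expand-zero []       x = refl
    expand-zero (w ∷ ws) x = trans (+-cong (zeroˡ (w x)) (expand-zero ws x)) (+-identityˡ 0#)

    expand-+ : ∀ {b} (ws : Vec (Vect I) b) (u v : Vect (Fin b)) → expand ws (u +v v) ≈v (expand ws u +v expand ws v)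
    expand-+ []       u v x = sym (+-identityˡ 0#)
    expand-+ (w ∷ ws) u v x = begin
      (u fzero + v fzero) * w x + expand ws (tail u +v tail v) x
        ≈⟨ +-cong (distribʳ (w x) (u fzero) (v fzero)) (expand-+ ws (tail u) (tail v) x) ⟩
      (u fzero * w x + v fzero * w x) + (expand ws (tail u) x + expand ws (tail v) x)
        ≈⟨ solve 4 (λ p q r s → (p :+ q) :+ (r :+ s) := (p :+ r) :+ (q :+ s)) refl _ _ _ _ ⟩
      (u fzero * w x + expand ws (tail u) x) + (v fzero * w x + expand ws (tail v) x) ∎

    expand-· : ∀ {b} (ws : Vec (Vect I) b) a (u : Vect (Fin b)) → expand ws (a ·v u) ≈v (a ·v expand ws u)
    expand-· []       a u x = sym (zeroʳ a)
    expand-· (w ∷ ws) a u x =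
      trans (+-cong (*-assoc a (u fzero) (w x)) (expand-· ws a (tail u) x)) (sym (distribˡ a _ _))

    expand-cong : ∀ {b} (ws : Vec (Vect I) b) {u v : Vect (Fin b)} → u ≈v v → expand ws u ≈v expand ws v
    expand-cong []       u≈v x = refl
    expand-cong (w ∷ ws) u≈v x = +-cong (*-congʳ (u≈v fzero)) (expand-cong ws (u≈v ∘ fsuc) x)

    expand-lincomb : ∀ {a b} (ws : Vec (Vect I) b) (as : Vec Carrier a) (cs : Vec (Vect (Fin b)) a) →
                     expand ws (lincomb as cs) ≈v lincomb as (map (expand ws) cs)
    expand-lincomb ws []       []       = expand-zero ws
    expand-lincomb ws (a ∷ as) (c ∷ cs) x = begin
      expand ws ((a ·v c) +v lincomb as cs) x                   ≈⟨ expand-+ ws (a ·v c) (lincomb as cs) x ⟩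
      expand ws (a ·v c) x + expand ws (lincomb as cs) x        ≈⟨ +-cong (expand-· ws a c x) (expand-lincomb ws as cs x) ⟩
      a * expand ws c x + lincomb as (map (expand ws) cs) x     ∎

    independent-in-span-≤ : ∀ {a b} (vs : Vec (Vect I) a) (ws : Vec (Vect I) b) →
                            LinIndep vs → (∀ t → Span ws (lookup vs t)) → a ≤ b
    independent-in-span-≤ {a} {b} vs ws indep span with b ℕₚ.<? a
    ... | no b≮a  = ℕₚ.≮⇒≥ b≮a
    ... | yes b<a = ⊥-elim (independent⇒¬dependency indep
                              (transfer-dependency relate (overfull-dependent b b<a coords)))
      where
        coords : Vec (Vect (Fin b)) a
        coords = tabulate (λ t → lookup (proj₁ (span t)))

        expand-coords : ∀ t → lookup (map (expand ws) coords) t ≈v lookup vs t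
        expand-coords t rewrite Vecₚ.lookup-map t (expand ws) coords
                              | Vecₚ.lookup∘tabulate (λ t → lookup (proj₁ (span t))) t
                              | Vecₚ.tabulate∘lookup (proj₁ (span t)) = proj₂ (span t)

        relate : ∀ as → lincomb as coords ≈v 0v → lincomb as vs ≈v 0v
        relate as rel x = begin
          lincomb as vs x                        ≈⟨ lincomb-congʳ as expand-coords x ⟨
          lincomb as (map (expand ws) coords) x  ≈⟨ expand-lincomb ws as coords x ⟨
          expand ws (lincomb as coords) x        ≈⟨ expand-cong ws rel x ⟩
          expand ws 0v x                         ≈⟨ expand-zero ws x ⟩
          0#                                     ∎

    Span-zero : ∀ {b} (ws : Vec (Vect I) b) {v} → v ≈v 0v → Span ws v
    Span-zero {b} ws v≈0 = replicate b 0# , λ x → trans (lincomb-zeros ws x) (sym (v≈0 x))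

    Span-here : ∀ {b} (ws : Vec (Vect I) b) w → Span (w ∷ ws) w
    Span-here {b} ws w = 1# ∷ replicate b 0# ,
      λ x → trans (+-cong (*-identityˡ (w x)) (lincomb-zeros ws x)) (+-identityʳ (w x))

    Span-there : ∀ {b} {ws : Vec (Vect I) b} w {v} → Span ws v → Span (w ∷ ws) v
    Span-there w (cs , cs≈v) = 0# ∷ cs , λ x → trans (+-cong (zeroˡ (w x)) (cs≈v x)) (+-identityˡ _)

    independent-∷ : ∀ {b} (ws : Vec (Vect I) b) w → LinIndep ws → ¬ Span ws w → LinIndep (w ∷ ws)
    independent-∷ ws w indep w∉ (a ∷ as) rel with a ≟ 0#
    ... | yes a≈0 = a≈0 , indep as (drop-zero-head as ws a≈0 rel)
    ... | no a≉0 = ⊥-elim (w∉ (map (- y *_) as , λ x → begin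
      lincomb (map (- y *_) as) ws x  ≈⟨ lincomb-scale (- y) as ws x ⟩
      - y * lincomb as ws x           ≈⟨ *-congˡ (+-inverseʳ-unique (a * w x) _ (rel x)) ⟩
      - y * - (a * w x)               ≈⟨ -‿distribˡ-* y _ ⟨
      - (y * - (a * w x))             ≈⟨ -‿cong (-‿distribʳ-* y _) ⟨
      - - (y * (a * w x))             ≈⟨ -‿involutive _ ⟩
      y * (a * w x)                   ≈⟨ *-assoc y a (w x) ⟨
      (y * a) * w x                   ≈⟨ *-congʳ (trans (*-comm y a) (proj₂ (inverse a a≉0))) ⟩
      1# * w x                        ≈⟨ *-identityˡ (w x) ⟩
      w x                             ∎))
      where y = proj₁ (inverse a a≉0)

  any-coefficients? : ∀ {p} n (Q : Vec Carrier n → Set p) → (∀ as → Dec (Q as)) →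
                      (∀ {as bs} → Pointwise _≈_ as bs → Q as → Q bs) → Dec (∃ Q)
  any-coefficients? zero Q Q? resp with Q? []
  ... | yes q = yes ([] , q)
  ... | no ¬q = no λ { ([] , q) → ¬q q }
  any-coefficients? (suc n) Q Q? resp
    with Any.any? (λ a → any-coefficients? n (Q ∘ (a ∷_)) (Q? ∘ (a ∷_)) (resp ∘ (refl ∷_))) elements
  ... | yes found = let (a , as , q) = Any.satisfied found in yes (a ∷ as , q)
  ... | no ¬found = no λ { (a ∷ as , q) →
          let (b , b∈ , a≈b) = complete a in
          ¬found (Mem.lose b∈ (as , resp (a≈b ∷ Pointwise.refl refl) q)) }

  Span? : ∀ {m b} (ws : Vec (Vect (Fin m)) b) v → Dec (Span ws v)
  Span? {b = b} ws v = any-coefficients? b (λ cs → lincomb cs ws ≈v v)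
    (λ cs → Fin.all? (λ x → lincomb cs ws x ≟ v x))
    (λ as≈bs rel x → trans (sym (lincomb-cong ws as≈bs x)) (rel x))

  Pos : ℕ → ℕ → Set
  Pos k m = Fin k × Fin m

  ≺-asym : ∀ {k m} → Asymmetric (_≺_ {k} {m})
  ≺-asym {x = _ , _} {_ , _} (inj₁ i<i′)           (inj₁ i′<i)         = ℕₚ.<-asym i<i′ i′<i
  ≺-asym {x = _ , _} {_ , _} (inj₁ i<i)            (inj₂ (≡.refl , _)) = ℕₚ.<-irrefl ≡.refl i<i
  ≺-asym {x = _ , _} {_ , _} (inj₂ (≡.refl , _))   (inj₁ i<i)          = ℕₚ.<-irrefl ≡.refl i<i
  ≺-asym {x = _ , _} {_ , _} (inj₂ (≡.refl , j<j′)) (inj₂ (_ , j′<j))  = ℕₚ.<-asym j<j′ j′<j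

  _≺?_ : ∀ {k m} (p q : Pos k m) → Dec (p ≺ q)
  (i , j) ≺? (i′ , j′) = (toℕ i ℕₚ.<? toℕ i′) ⊎-dec ((i Fin.≟ i′) ×-dec (toℕ j ℕₚ.<? toℕ j′))

  positions : ∀ k m → List (Pos k m)
  positions zero    m = []
  positions (suc k) m = L.map (fzero ,_) (L.allFin m) L.++ L.map (Product.map₁ fsuc) (positions k m)

  ∈-positions : ∀ {k m} (p : Pos k m) → p ∈ positions k m
  ∈-positions         (fzero  , j) = Memₚ.∈-++⁺ˡ (Memₚ.∈-map⁺ (fzero ,_) (Memₚ.∈-allFin j))
  ∈-positions {suc k} {m} (fsuc i , j) =
    Memₚ.∈-++⁺ʳ (L.map (fzero ,_) (L.allFin m)) (Memₚ.∈-map⁺ (Product.map₁ fsuc) (∈-positions (i , j)))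

  positions-sorted : ∀ k m → AllPairs _≺_ (positions k m)
  positions-sorted zero    m = []
  positions-sorted (suc k) m = AllPairsₚ.++⁺ first-row later-rows first≺later
    where
      first-row : AllPairs _≺_ (L.map (fzero ,_) (L.allFin m))
      first-row = AllPairsₚ.map⁺ (AllPairsₚ.tabulate⁺-< (λ j<j′ → inj₂ (≡.refl , j<j′)))

      next-row : ∀ {p q : Pos k m} → p ≺ q → Product.map₁ fsuc p ≺ Product.map₁ fsuc q
      next-row {_ , _} {_ , _} (inj₁ i<i′)           = inj₁ (s≤s i<i′)
      next-row {_ , _} {_ , _} (inj₂ (≡.refl , j<j′)) = inj₂ (≡.refl , j<j′)

      later-rows : AllPairs _≺_ (L.map (Product.map₁ fsuc) (positions k m))
      later-rows = AllPairsₚ.map⁺ (AllPairs.map next-row (positions-sorted k m))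

      first≺later : All.All (λ p → All.All (p ≺_) (L.map (Product.map₁ fsuc) (positions k m)))
                            (L.map (fzero ,_) (L.allFin m))
      first≺later = Allₚ.map⁺ (All.universal (λ _ → Allₚ.map⁺ (All.universal (λ _ → inj₁ (s≤s z≤n)) _)) _)

  initial-entry : ∀ {k m} (M : Matrix k m) {q} → ¬ flat M q ≈ 0# → ∃[ p ] IsInitial M p
  initial-entry {k} {m} M Mq≉0
    with first-minimal ≺-asym (λ p → ¬? (flat M p ≟ 0#)) (positions-sorted k m) (λ {p} _ → ∈-positions p) Mq≉0
  ... | (i , j) , Mp≉0 , minimal =
    (i , j) , Mp≉0 , λ i′ j′ before → decidable-stable (M i′ j′ ≟ 0#) (minimal before)

  IsInitial? : ∀ {k m} (M : Matrix k m) p → Dec (IsInitial M p)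
  IsInitial? M (i , j) =
    ¬? (M i j ≟ 0#) ×-dec Fin.all? (λ i′ → Fin.all? (λ j′ → ((i′ , j′) ≺? (i , j)) →-dec (M i′ j′ ≟ 0#)))

  IsInitial-resp : ∀ {k m} {M N : Matrix k m} {p} → M ≈M N → IsInitial M p → IsInitial N p
  IsInitial-resp {p = i , j} M≈N (Mp≉0 , before) =
    (λ Np≈0 → Mp≉0 (trans (M≈N i j) Np≈0)) , λ i′ j′ p′≺p → trans (sym (M≈N i′ j′)) (before i′ j′ p′≺p)

  -- Matrices whose initial entries strictly increase (an echelon family) are independent:
  -- at the first initial position only the first matrix is nonzero.
  echelon-independent : ∀ {k m} (ps : List (Pos k m)) (Ms : Vec (Matrix k m) (L.length ps)) →
    AllPairs _≺_ ps → (∀ t → IsInitial (lookup Ms t) (L.lookup ps t)) → LinIndep (map flat Ms)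
  echelon-independent []             []       _                  _       []       _   = _
  echelon-independent ((i , j) ∷ ps) (M ∷ Ms) (p≺ps ∷ sorted) initial (a ∷ as) rel =
    a≈0 , echelon-independent ps Ms sorted (initial ∘ fsuc) as (drop-zero-head as (map flat Ms) a≈0 rel)
    where
      later≈0 : ∀ t → lookup (map flat Ms) t (i , j) ≈ 0#
      later≈0 t rewrite Vecₚ.lookup-map t flat Ms =
        proj₂ (initial (fsuc t)) i j (All.lookup p≺ps (Memₚ.∈-lookup t))
      a≈0 : a ≈ 0#
      a≈0 = cancel-nonzero (proj₁ (initial fzero)) (begin
        M i j * a                                      ≈⟨ *-comm (M i j) a ⟩
        a * M i j                                      ≈⟨ +-identityʳ _ ⟨
        a * M i j + 0#                                 ≈⟨ +-congˡ (lincomb-vanishing as (map flat Ms) (i , j) later≈0) ⟨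
        a * M i j + lincomb as (map flat Ms) (i , j)   ≈⟨ rel (i , j) ⟩
        0#                                             ∎)

  lincomb-∈ : ∀ {k m r} (C : LinearCode k m) (as : Vec Carrier r) (Ms : Vec (Matrix k m) r) →
              (∀ t → lookup Ms t ∈C C) → (λ i j → lincomb as (map flat Ms) (i , j)) ∈C C
  lincomb-∈ C []       []       _    = zero∈ C
  lincomb-∈ C (a ∷ as) (M ∷ Ms) Ms∈C = +-closed C (·-closed C a (Ms∈C fzero)) (lincomb-∈ C as Ms (Ms∈C ∘ fsuc))

  -- A codeword vanishing at every position of in(C) is zero: otherwise its own initial entry is in in(C).
  vanishing-on-initials : ∀ {k m} (C : LinearCode k m) {V} → V ∈C C →
                          (∀ p → InSet C p → flat V p ≈ 0#) → flat V ≈v 0v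
  vanishing-on-initials C {V} V∈C vanish (i , j) = decidable-stable (V i j ≟ 0#) λ Vij≉0 →
    let (p , initial) = initial-entry V Vij≉0
    in proj₁ initial (vanish p (V , V∈C , (λ V≈0 → Vij≉0 (V≈0 i j)) , initial))

  module Dimension {k m} (C : LinearCode k m) {n} (dim : HasDim C n) where
    B : Vec (Matrix k m) n
    B = proj₁ dim

    B∈C : ∀ t → lookup B t ∈C C
    B∈C = proj₁ (proj₂ dim)

    B-independent : LinIndep (map flat B)
    B-independent = proj₁ (proj₂ (proj₂ dim))

    B-spans : ∀ M → M ∈C C → Span (map flat B) (flat M)
    B-spans = proj₂ (proj₂ (proj₂ dim))

    codeword : Vec Carrier n → Matrix k m
    codeword as i j = lincomb as (map flat B) (i , j)

    -- p ∈ in(C) is decidable: it asks for a coordinate vector whose codeword starts at p.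
    InSet? : ∀ p → Dec (InSet C p)
    InSet? p with any-coefficients? n (λ as → IsInitial (codeword as) p) (λ as → IsInitial? (codeword as) p)
                    (λ as≈bs → IsInitial-resp (λ i j → lincomb-cong (map flat B) as≈bs (i , j)))
    ... | yes (as , initial) = yes (codeword as , lincomb-∈ C as B B∈C , nonzero initial , initial)
      where
        nonzero : ∀ {M : Matrix k m} {i j} → IsInitial M (i , j) → NonZero M
        nonzero {i = i} {j} (Mij≉0 , _) M≈0 = Mij≉0 (M≈0 i j)
    ... | no none = no λ (M , M∈C , _ , initial) →
      let (as , as≈M) = B-spans M M∈C
      in none (as , IsInitial-resp (λ i j → sym (as≈M (i , j))) initial)

    initials : List (Pos k m)
    initials = L.filter InSet? (positions k m)

    initials-sorted : AllPairs _≺_ initials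
    initials-sorted = AllPairsₚ.filter⁺ InSet? (positions-sorted k m)

    initials-unique : Unique initials
    initials-unique = AllPairs.map (λ { p≺p ≡.refl → ≺-asym p≺p p≺p }) initials-sorted

    initials-sound : ∀ p → p ∈ initials → InSet C p
    initials-sound p p∈ = proj₂ (Memₚ.∈-filter⁻ InSet? {xs = positions k m} p∈)

    initials-complete : ∀ p → InSet C p → p ∈ initials
    initials-complete p p∈in = Memₚ.∈-filter⁺ InSet? (∈-positions p) p∈in

    -- |in(C)| ≤ n: codewords starting at the positions of in(C) form an echelon family in C.
    initials≤dim : L.length initials ≤ n
    initials≤dim = independent-in-span-≤ (map flat witnesses) (map flat B)
      (echelon-independent initials witnesses initials-sorted witness-initial) witness-spanned
      where
        witness : ∀ t → InSet C (L.lookup initials t)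
        witness t = initials-sound _ (Memₚ.∈-lookup t)

        witnesses : Vec (Matrix k m) (L.length initials)
        witnesses = tabulate (proj₁ ∘ witness)

        witness-initial : ∀ t → IsInitial (lookup witnesses t) (L.lookup initials t)
        witness-initial t rewrite Vecₚ.lookup∘tabulate (proj₁ ∘ witness) t = proj₂ (proj₂ (proj₂ (witness t)))

        witness-spanned : ∀ t → Span (map flat B) (lookup (map flat witnesses) t)
        witness-spanned t rewrite Vecₚ.lookup-map t flat witnesses | Vecₚ.lookup∘tabulate (proj₁ ∘ witness) t =
          B-spans _ (proj₁ (proj₂ (witness t)))

    -- n ≤ |in(C)|: restricting codewords to the positions of in(C) is injective,
    -- so the restrictions of B stay independent in F^|in(C)|.
    dim≤initials : n ≤ L.length initials
    dim≤initials with L.length initials ℕₚ.<? n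
    ... | no t≮n  = ℕₚ.≮⇒≥ t≮n
    ... | yes t<n = ⊥-elim (independent⇒¬dependency B-independent
                              (transfer-dependency relate (overfull-dependent _ t<n restricted)))
      where
        restricted : Vec (Vect (Fin (L.length initials))) n
        restricted = map (λ v u → v (L.lookup initials u)) (map flat B)

        relate : ∀ as → lincomb as restricted ≈v 0v → lincomb as (map flat B) ≈v 0v
        relate as rel = vanishing-on-initials C (lincomb-∈ C as B B∈C) vanish
          where
            vanish : ∀ p → InSet C p → lincomb as (map flat B) p ≈ 0#
            vanish p p∈in with initials-complete p p∈in
            ... | p∈ rewrite Anyₚ.lookup-index p∈ =
              ≡.subst (_≈ 0#) (lincomb-reindex (L.lookup initials) as (map flat B) (Any.index p∈)) (rel (Any.index p∈))

    dimension : HasCard (InSet C) n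
    dimension = initials , ℕₚ.≤-antisym initials≤dim dim≤initials , initials-unique , initials-sound , initials-complete

  module RowRank {k m} (M : Matrix k m) where

    record RowBasis (xs : List (Fin k)) : Set (c ⊔ ℓ) where
      field
        size        : ℕ
        rows        : Vec (Fin k) size
        distinct    : Unique (Vec.toList rows)
        independent : LinIndep (map M rows)
        spans       : ∀ x → x ∈ xs → Span (map M rows) (M x)
        size≤       : size ≤ L.length xs

    basis-row-spanned : ∀ {g} (G : Vec (Fin k) g) {x} → x ∈ Vec.toList G → Span (map M G) (M x)
    basis-row-spanned (y ∷ G) (here ≡.refl) = Span-here (map M G) (M y)
    basis-row-spanned (y ∷ G) (there x∈G)   = Span-there (M y) (basis-row-spanned G x∈G)

    row-basis : ∀ xs → RowBasis xs
    row-basis [] = record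
      { size = 0 ; rows = [] ; distinct = [] ; independent = λ { [] _ → _ } ; spans = λ _ () ; size≤ = z≤n }
    row-basis (x ∷ xs) with row-basis xs
    ... | B with Span? (map M (RowBasis.rows B)) (M x)
    ...   | yes x-spanned = record
      { size = size ; rows = rows ; distinct = distinct ; independent = independent
      ; spans = spans′ ; size≤ = ℕₚ.m≤n⇒m≤1+n size≤ }
      where
        open RowBasis B
        spans′ : ∀ z → z ∈ x ∷ xs → Span (map M rows) (M z)
        spans′ z (here ≡.refl) = x-spanned
        spans′ z (there z∈xs)  = spans z z∈xs
    ...   | no x-new = record
      { size        = suc size
      ; rows        = x ∷ rows
      ; distinct    = All.tabulate (λ y∈G x≡y → x-new (basis-row-spanned rows (≡.subst (_∈ _) (≡.sym x≡y) y∈G)))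
                      ∷ distinct
      ; independent = independent-∷ (map M rows) (M x) independent x-new
      ; spans       = spans′
      ; size≤       = s≤s size≤
      }
      where
        open RowBasis B
        spans′ : ∀ z → z ∈ x ∷ xs → Span (M x ∷ map M rows) (M z)
        spans′ z (here ≡.refl) = Span-here (map M rows) (M x)
        spans′ z (there z∈xs)  = Span-there (M x) (spans z z∈xs)

    rank-bound : ∀ xs → (∀ x → x ∈ xs ⊎ M x ≈v 0v) → ∃[ r ] (HasRank M r × r ≤ L.length xs)
    rank-bound xs covers = size , ((rows , distinct , independent) , maximal) , size≤
      where
        open RowBasis (row-basis xs)
        spanned : ∀ x → Span (map M rows) (M x)
        spanned x with covers x
        ... | inj₁ x∈xs  = spans x x∈xs
        ... | inj₂ x≈0   = Span-zero (map M rows) x≈0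
        maximal : ∀ {s} (G : Vec (Fin k) s) → LinIndep (map M G) → s ≤ size
        maximal G indep = independent-in-span-≤ (map M G) (map M rows) indep
          (λ t → ≡.subst (Span (map M rows)) (≡.sym (Vecₚ.lookup-map t M G)) (spanned (lookup G t)))

  -- A matrix whose initial entry lies in row i has rank at most k - i,
  -- since its rows above row i vanish.
  initial-row-rank : ∀ {k m} (M : Matrix k m) {i j} → IsInitial M (i , j) →
                     ∃[ r ] (HasRank M r × r ≤ k ℕ.∸ toℕ i)
  initial-row-rank {k} M {i} (_ , above≈0) with RowRank.rank-bound M (rowsFrom k (toℕ i)) covers
    where
      covers : ∀ x → x ∈ rowsFrom k (toℕ i) ⊎ M x ≈v 0v
      covers x with toℕ x ℕₚ.<? toℕ i
      ... | yes x<i = inj₂ (λ y → above≈0 x y (inj₁ x<i))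
      ... | no x≮i  = inj₁ (∈-rowsFrom x (ℕₚ.≮⇒≥ x≮i))
  ... | r , rank , r≤ = r , rank , ≡.subst (r ≤_) (length-rowsFrom k (toℕ i)) r≤

  initial-row-bound : ∀ {k m} (C : LinearCode k m) {d} → HasMinDist C d →
                      ∀ {i j} → InSet C (i , j) → toℕ i ℕ.+ d ≤ k
  initial-row-bound {k} C {d} (_ , minimal) {i} (M , M∈C , M≢0 , initial) with initial-row-rank M initial
  ... | r , rank , r≤k∸i = ℕₚ.≤-trans (ℕₚ.+-monoʳ-≤ (toℕ i) d≤k∸i) (ℕₚ.≤-reflexive i+[k∸i]≡k)
    where
      d≤k∸i : d ≤ k ℕ.∸ toℕ i
      d≤k∸i = ℕₚ.≤-trans (minimal M r M∈C M≢0 rank) r≤k∸i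
      i+[k∸i]≡k : toℕ i ℕ.+ (k ℕ.∸ toℕ i) ≡ k
      i+[k∸i]≡k = ℕₚ.m+[n∸m]≡n (ℕₚ.<⇒≤ (Fin.toℕ<n i))

open import Data.Nat using (_+_)

lemma5p3 : ∀ {c ℓ} (F : FiniteField c ℓ) (k m : ℕ) → k ≤ m →
    let open LinAlg F in
    (C : LinearCode k m) → NonZeroCode C →
      (∀ n → HasDim C n → HasCard (InSet C) n)
      × (∀ d → HasMinDist C d → ∀ i j → InSet C (i , j) → toℕ i + d ≤ k)
lemma5p3 F k m _ C _ =
  (λ n dim → Dimension.dimension C dim) ,
  (λ d minDist i j initial → initial-row-bound C minDist initial)
  where open Theory F
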